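{- Let $\theta$ be any root of $x^3-x-1$, and let $(a,b,c,d,e,f)$ be any one of the following fifteen 6-tuples: $(1,-1,1,-1,-2,1)$, $(1,-1,1,-2,-1,1)$, $(1,1,-1,-2,1,1)$, $(1,1,2,-2,3,1)$, $(1,-1,3,2,-2,1)$, $(1,-1,3,-2,2,1)$, $(2,-1,-1,1,-6,1)$, $(2,-1,-1,-6,1,1)$, $(1,1,1,-6,-1,2)$, $(2,1,2,-2,5,1)$, $(1,-1,5,-2,2,2)$, $(1,-2,5,2,-2,1)$, $(1,-1,7,-7,2,4)$, $(1,-4,7,2,-7,1)$, $(1,4,-7,2,7,1)$. Then for every integer $m$, \[ a\theta^{m+c}+b\theta^{m+d}=f\theta^{m+e}. \] -}

module Defs where

open import Level using (Level)
open import Data.Nat using (ℕ; suc)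
open import Data.Integer using (ℤ; +_; -[1+_]) renaming (-_ to neg)
open import Data.Product using (_,_) renaming (_×_ to _⊗_)
open import Data.List using (List; []; _∷_)
open import Algebra.Bundles using (CommutativeRing)

Tuple : Set
Tuple = ℤ ⊗ ℤ ⊗ ℤ ⊗ ℤ ⊗ ℤ ⊗ ℤ

tuples : List Tuple
tuples =
    (+ 1 , neg (+ 1) , + 1 , neg (+ 1) , neg (+ 2) , + 1)
  ∷ (+ 1 , neg (+ 1) , + 1 , neg (+ 2) , neg (+ 1) , + 1)
  ∷ (+ 1 , + 1 , neg (+ 1) , neg (+ 2) , + 1 , + 1)
  ∷ (+ 1 , + 1 , + 2 , neg (+ 2) , + 3 , + 1)
  ∷ (+ 1 , neg (+ 1) , + 3 , + 2 , neg (+ 2) , + 1)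
  ∷ (+ 1 , neg (+ 1) , + 3 , neg (+ 2) , + 2 , + 1)
  ∷ (+ 2 , neg (+ 1) , neg (+ 1) , + 1 , neg (+ 6) , + 1)
  ∷ (+ 2 , neg (+ 1) , neg (+ 1) , neg (+ 6) , + 1 , + 1)
  ∷ (+ 1 , + 1 , + 1 , neg (+ 6) , neg (+ 1) , + 2)
  ∷ (+ 2 , + 1 , + 2 , neg (+ 2) , + 5 , + 1)
  ∷ (+ 1 , neg (+ 1) , + 5 , neg (+ 2) , + 2 , + 2)
  ∷ (+ 1 , neg (+ 2) , + 5 , + 2 , neg (+ 2) , + 1)
  ∷ (+ 1 , neg (+ 1) , + 7 , neg (+ 7) , + 2 , + 4)
  ∷ (+ 1 , neg (+ 4) , + 7 , + 2 , neg (+ 7) , + 1)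
  ∷ (+ 1 , + 4 , neg (+ 7) , + 2 , + 7 , + 1)
  ∷ []

module _ {c ℓ : Level} (R : CommutativeRing c ℓ) where
  open CommutativeRing R

  _^_ : Carrier → ℕ → Carrier
  x ^ 0 = 1#
  x ^ suc n = x * (x ^ n)

  ⟦_⟧ℕ : ℕ → Carrier
  ⟦ 0 ⟧ℕ = 0#
  ⟦ suc n ⟧ℕ = 1# + ⟦ n ⟧ℕ

  ⟦_⟧ℤ : ℤ → Carrier
  ⟦ + n ⟧ℤ = ⟦ n ⟧ℕ
  ⟦ -[1+ n ] ⟧ℤ = - ⟦ suc n ⟧ℕ

  zpow : Carrier → Carrier → ℤ → Carrier
  zpow θ θ⁻¹ (+ n) = θ ^ n
  zpow θ θ⁻¹ -[1+ n ] = θ⁻¹ ^ suc n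

module Submission where

-- In ℕ[X]/(X³ − X − 1) every power Xⁿ has coordinates
-- (p₀(n), p₁(n), p₂(n)) ∈ ℕ³ with respect to 1, X, X², obtained from the
-- recurrence X³⁺ⁿ = X¹⁺ⁿ + Xⁿ.  Dually, in any commutative monoid a sequence
-- v with v(n+3) = v(n+1) + v(n) satisfies v(n) = p₀(n)·v₀ + p₁(n)·v₁ + p₂(n)·v₂,
-- so an identity α·Xⁱ + β·Xʲ = γ·Xᵏ + δ·Xˡ between coordinate vectors, which
-- can be checked by computation, transfers to every such sequence.
--
-- Each of the fifteen tuples
-- then corresponds to one identity among at most three powers of X, shifted by
-- the smallest exponent; the theorem looks up the tuple in this list.

open import Defs
open import Level using (Level)
open import Data.Nat using (ℕ; zero; suc) renaming (_+_ to _+ℕ_; _*_ to _*ℕ_)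
import Data.Nat.Properties as ℕP
open import Data.Integer using (ℤ; +_; -[1+_]) renaming (_+_ to _+ℤ_)
import Data.Integer.Properties as ℤP
open import Data.Product using (_,_) renaming (_×_ to _⊗_)
open import Data.List.Membership.Propositional using (_∈_)
open import Data.List.Relation.Unary.All using (All; []; _∷_; lookup)
open import Algebra.Bundles using (CommutativeMonoid; CommutativeRing)
open import Relation.Binary.PropositionalEquality as ≡ using (_≡_)

module PadovanCoordinates {a ℓ : Level} (M : CommutativeMonoid a ℓ) where
  open CommutativeMonoid M
    renaming (_∙_ to _+_; ε to 0#; ∙-cong to +-cong; identityʳ to +-identityʳ)
  open import Algebra.Properties.CommutativeMonoid.Mult M
    using (_×_; ×-congʳ; ×-homo-+; ×-assocˡ; ×-distrib-+)
  open import Algebra.Properties.CommutativeSemigroup commutativeSemigroup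
    using (interchange)
  open import Relation.Binary.Reasoning.Setoid setoid

  Coords : Set
  Coords = ℕ ⊗ ℕ ⊗ ℕ

  infixl 6 _⊕_
  infixr 7 _⊛_

  _⊕_ : Coords → Coords → Coords
  (a , b , c) ⊕ (a′ , b′ , c′) = (a +ℕ a′ , b +ℕ b′ , c +ℕ c′)

  _⊛_ : ℕ → Coords → Coords
  k ⊛ (a , b , c) = (k *ℕ a , k *ℕ b , k *ℕ c)

  X^ : ℕ → Coords
  X^ 0 = (1 , 0 , 0)
  X^ 1 = (0 , 1 , 0)
  X^ 2 = (0 , 0 , 1)
  X^ (suc (suc (suc n))) = X^ (suc n) ⊕ X^ n

  binomial : ℕ → ℕ → ℕ → ℕ → Coords
  binomial α i β j = α ⊛ X^ i ⊕ β ⊛ X^ j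

  module Evaluation (u₀ u₁ u₂ : Carrier) where
    eval : Coords → Carrier
    eval (a , b , c) = a × u₀ + b × u₁ + c × u₂

    eval-⊕ : ∀ s t → eval (s ⊕ t) ≈ eval s + eval t
    eval-⊕ (a , b , c) (a′ , b′ , c′) = begin
      (a +ℕ a′) × u₀ + (b +ℕ b′) × u₁ + (c +ℕ c′) × u₂
        ≈⟨ +-cong (+-cong (×-homo-+ u₀ a a′) (×-homo-+ u₁ b b′)) (×-homo-+ u₂ c c′) ⟩
      (a × u₀ + a′ × u₀) + (b × u₁ + b′ × u₁) + (c × u₂ + c′ × u₂)
        ≈⟨ +-cong (interchange _ _ _ _) refl ⟩
      (a × u₀ + b × u₁) + (a′ × u₀ + b′ × u₁) + (c × u₂ + c′ × u₂)
        ≈⟨ interchange _ _ _ _ ⟩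
      eval (a , b , c) + eval (a′ , b′ , c′) ∎

    eval-⊛ : ∀ k t → eval (k ⊛ t) ≈ k × eval t
    eval-⊛ k (a , b , c) = begin
      (k *ℕ a) × u₀ + (k *ℕ b) × u₁ + (k *ℕ c) × u₂
        ≈⟨ +-cong (+-cong (×-assocˡ u₀ k a) (×-assocˡ u₁ k b)) (×-assocˡ u₂ k c) ⟨
      k × (a × u₀) + k × (b × u₁) + k × (c × u₂)
        ≈⟨ +-cong (×-distrib-+ _ _ k) refl ⟨
      k × (a × u₀ + b × u₁) + k × (c × u₂)
        ≈⟨ ×-distrib-+ _ _ k ⟨
      k × eval (a , b , c) ∎

  module Recurrent (v : ℕ → Carrier) (recurrence : ∀ n → v (3 +ℕ n) ≈ v (1 +ℕ n) + v n) where
    open Evaluation (v 0) (v 1) (v 2)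

    v≈eval : ∀ n → v n ≈ eval (X^ n)
    v≈eval 0 = sym (trans (+-identityʳ _) (trans (+-identityʳ _) (+-identityʳ _)))
    v≈eval 1 = sym (trans (+-identityʳ _) (trans (identityˡ _) (+-identityʳ _)))
    v≈eval 2 = sym (trans (+-cong (identityˡ 0#) (+-identityʳ _)) (identityˡ _))
    v≈eval (suc (suc (suc n))) = begin
      v (3 +ℕ n)                        ≈⟨ recurrence n ⟩
      v (1 +ℕ n) + v n                  ≈⟨ +-cong (v≈eval (suc n)) (v≈eval n) ⟩
      eval (X^ (suc n)) + eval (X^ n)   ≈⟨ eval-⊕ (X^ (suc n)) (X^ n) ⟨
      eval (X^ (3 +ℕ n))                ∎

    binomial-eval : ∀ α i β j → α × v i + β × v j ≈ eval (binomial α i β j)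
    binomial-eval α i β j = begin
      α × v i + β × v j                          ≈⟨ +-cong (×-congʳ α (v≈eval i)) (×-congʳ β (v≈eval j)) ⟩
      α × eval (X^ i) + β × eval (X^ j)          ≈⟨ +-cong (eval-⊛ α (X^ i)) (eval-⊛ β (X^ j)) ⟨
      eval (α ⊛ X^ i) + eval (β ⊛ X^ j)          ≈⟨ eval-⊕ (α ⊛ X^ i) (β ⊛ X^ j) ⟨
      eval (binomial α i β j)                    ∎

    transfer : ∀ α i β j γ k δ l → binomial α i β j ≡ binomial γ k δ l →
               α × v i + β × v j ≈ γ × v k + δ × v l
    transfer α i β j γ k δ l eq = begin
      α × v i + β × v j          ≈⟨ binomial-eval α i β j ⟩
      eval (binomial α i β j)    ≡⟨ ≡.cong eval eq ⟩
      eval (binomial γ k δ l)    ≈⟨ binomial-eval γ k δ l ⟨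
      γ × v k + δ × v l          ∎

shifted-suc : ∀ m s n → m +ℤ (s +ℤ + suc n) ≡ (m +ℤ (s +ℤ + n)) +ℤ + 1
shifted-suc m s n = begin
  m +ℤ (s +ℤ + suc n)             ≡⟨ ≡.cong (λ k → m +ℤ (s +ℤ + k)) (ℕP.+-comm 1 n) ⟩
  m +ℤ (s +ℤ (+ n +ℤ + 1))        ≡⟨ ≡.cong (m +ℤ_) (ℤP.+-assoc s (+ n) (+ 1)) ⟨
  m +ℤ ((s +ℤ + n) +ℤ + 1)        ≡⟨ ℤP.+-assoc m (s +ℤ + n) (+ 1) ⟨
  (m +ℤ (s +ℤ + n)) +ℤ + 1        ∎
  where open ≡.≡-Reasoning

module RootOfPadovanCubic {c ℓ : Level} (R : CommutativeRing c ℓ) where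
  open CommutativeRing R
  open import Algebra.Properties.Ring ring using (-‿distribˡ-*)
  open import Algebra.Properties.Group +-group using (x∙y⁻¹≈ε⇒x≈y; //-rightDividesˡ; //-rightDividesʳ)
  open import Algebra.Properties.CommutativeMonoid.Mult +-commutativeMonoid using (_×_)
  open PadovanCoordinates +-commutativeMonoid using (binomial; module Recurrent)
  open import Relation.Binary.Reasoning.Setoid setoid

  ℕ-coefficient : ∀ n x → ⟦ R ⟧ℕ n * x ≈ n × x
  ℕ-coefficient zero x = zeroˡ x
  ℕ-coefficient (suc n) x = trans (distribʳ x 1# _) (+-cong (*-identityˡ x) (ℕ-coefficient n x))

  negative-coefficient : ∀ n x → ⟦ R ⟧ℤ -[1+ n ] * x ≈ - (suc n × x)
  negative-coefficient n x = trans (sym (-‿distribˡ-* _ x)) (-‿cong (ℕ-coefficient (suc n) x))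

  cube-of-root : ∀ θ → _^_ R θ 3 - θ - 1# ≈ 0# → _^_ R θ 3 ≈ 1# + θ
  cube-of-root θ root = begin
    _^_ R θ 3              ≈⟨ //-rightDividesˡ θ (_^_ R θ 3) ⟨
    (_^_ R θ 3 - θ) + θ    ≈⟨ +-cong (x∙y⁻¹≈ε⇒x≈y _ _ root) refl ⟩
    1# + θ                 ∎

  geometric-recurrence : ∀ θ → _^_ R θ 3 ≈ 1# + θ → (v : ℕ → Carrier) →
                         (∀ n → v (suc n) ≈ θ * v n) →
                         ∀ n → v (3 +ℕ n) ≈ v (1 +ℕ n) + v n
  geometric-recurrence θ cube v ratio n = begin
    v (3 +ℕ n)                   ≈⟨ trans (ratio (2 +ℕ n)) (*-cong refl (trans (ratio (1 +ℕ n)) (*-cong refl (ratio n)))) ⟩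
    θ * (θ * (θ * v n))          ≈⟨ trans (*-cong refl (sym (*-assoc θ θ (v n)))) (sym (*-assoc θ (θ * θ) (v n))) ⟩
    θ * (θ * θ) * v n            ≈⟨ *-cong (*-cong refl (*-cong refl (sym (*-identityʳ θ)))) refl ⟩
    _^_ R θ 3 * v n              ≈⟨ *-cong cube refl ⟩
    (1# + θ) * v n               ≈⟨ distribʳ (v n) 1# θ ⟩
    1# * v n + θ * v n           ≈⟨ +-comm _ _ ⟩
    θ * v n + 1# * v n           ≈⟨ +-cong (sym (ratio n)) (*-identityˡ (v n)) ⟩
    v (1 +ℕ n) + v n             ∎

  module Root (θ θ⁻¹ : Carrier) (root : _^_ R θ 3 - θ - 1# ≈ 0#) (inverse : θ * θ⁻¹ ≈ 1#) where
    zp : ℤ → Carrier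
    zp = zpow R θ θ⁻¹

    zpow-suc : ∀ y → zp (y +ℤ + 1) ≈ θ * zp y
    zpow-suc (+ n) = reflexive (≡.cong (_^_ R θ) (ℕP.+-comm n 1))
    zpow-suc -[1+ zero ] = sym (trans (*-cong refl (*-identityʳ θ⁻¹)) inverse)
    zpow-suc -[1+ suc n ] = begin
      θ⁻¹ ^′ suc n               ≈⟨ *-identityˡ _ ⟨
      1# * θ⁻¹ ^′ suc n          ≈⟨ *-cong inverse refl ⟨
      θ * θ⁻¹ * θ⁻¹ ^′ suc n     ≈⟨ *-assoc θ θ⁻¹ _ ⟩
      θ * θ⁻¹ ^′ suc (suc n)     ∎
      where _^′_ = _^_ R

    Identity : Tuple → Set ℓ
    Identity (a , b , c , d , e , f) =
      ∀ m → ⟦ R ⟧ℤ a * zp (m +ℤ c) + ⟦ R ⟧ℤ b * zp (m +ℤ d) ≈ ⟦ R ⟧ℤ f * zp (m +ℤ e)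

    module Shifted (m s : ℤ) where
      v : ℕ → Carrier
      v n = zp (m +ℤ (s +ℤ + n))

      ratio : ∀ n → v (suc n) ≈ θ * v n
      ratio n = trans (reflexive (≡.cong zp (shifted-suc m s n))) (zpow-suc (m +ℤ (s +ℤ + n)))

      open Recurrent v (geometric-recurrence θ (cube-of-root θ root) v ratio) public
        using (transfer)

    identity⁺ : ∀ s α i β j φ k → binomial α i β j ≡ binomial φ k 0 0 →
                Identity (+ α , + β , s +ℤ + i , s +ℤ + j , s +ℤ + k , + φ)
    identity⁺ s α i β j φ k eq m = begin
      ⟦ R ⟧ℕ α * v i + ⟦ R ⟧ℕ β * v j  ≈⟨ +-cong (ℕ-coefficient α (v i)) (ℕ-coefficient β (v j)) ⟩
      α × v i + β × v j                ≈⟨ transfer α i β j φ k 0 0 eq ⟩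
      φ × v k + 0#                     ≈⟨ +-identityʳ _ ⟩
      φ × v k                          ≈⟨ ℕ-coefficient φ (v k) ⟨
      ⟦ R ⟧ℕ φ * v k                   ∎
      where open Shifted m s

    identity⁻ : ∀ s α i n j φ k → binomial α i 0 0 ≡ binomial φ k (suc n) j →
                Identity (+ α , -[1+ n ] , s +ℤ + i , s +ℤ + j , s +ℤ + k , + φ)
    identity⁻ s α i n j φ k eq m = begin
      ⟦ R ⟧ℕ α * v i + ⟦ R ⟧ℤ -[1+ n ] * v j
        ≈⟨ +-cong (ℕ-coefficient α (v i)) (negative-coefficient n (v j)) ⟩
      α × v i - suc n × v j
        ≈⟨ +-cong (trans (sym (+-identityʳ _)) (transfer α i 0 0 φ k (suc n) j eq)) refl ⟩
      (φ × v k + suc n × v j) - suc n × v j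
        ≈⟨ //-rightDividesʳ (suc n × v j) (φ × v k) ⟩
      φ × v k
        ≈⟨ ℕ-coefficient φ (v k) ⟨
      ⟦ R ⟧ℕ φ * v k ∎
      where open Shifted m s

    -- The fifteen tuples, each justified by an identity in ℕ[X]/(X³ − X − 1)
    -- after shifting all exponents by the smallest one.
    fifteen-identities : All Identity tuples
    fifteen-identities =
        identity⁻ -[1+ 1 ] 1 3 0 1 1 0 ≡.refl      -- X³ − X = 1
      ∷ identity⁻ -[1+ 1 ] 1 3 0 0 1 1 ≡.refl      -- X³ − 1 = X
      ∷ identity⁺ -[1+ 1 ] 1 1 1 0 1 3 ≡.refl      -- X + 1 = X³
      ∷ identity⁺ -[1+ 1 ] 1 4 1 0 1 5 ≡.refl      -- X⁴ + 1 = X⁵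
      ∷ identity⁻ -[1+ 1 ] 1 5 0 4 1 0 ≡.refl      -- X⁵ − X⁴ = 1
      ∷ identity⁻ -[1+ 1 ] 1 5 0 0 1 4 ≡.refl      -- X⁵ − 1 = X⁴
      ∷ identity⁻ -[1+ 5 ] 2 5 0 7 1 0 ≡.refl      -- 2X⁵ − X⁷ = 1
      ∷ identity⁻ -[1+ 5 ] 2 5 0 0 1 7 ≡.refl      -- 2X⁵ − 1 = X⁷
      ∷ identity⁺ -[1+ 5 ] 1 7 1 0 2 5 ≡.refl      -- X⁷ + 1 = 2X⁵
      ∷ identity⁺ -[1+ 1 ] 2 4 1 0 1 7 ≡.refl      -- 2X⁴ + 1 = X⁷
      ∷ identity⁻ -[1+ 1 ] 1 7 0 0 2 4 ≡.refl      -- X⁷ − 1 = 2X⁴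
      ∷ identity⁻ -[1+ 1 ] 1 7 1 4 1 0 ≡.refl      -- X⁷ − 2X⁴ = 1
      ∷ identity⁻ -[1+ 6 ] 1 14 0 0 4 9 ≡.refl     -- X¹⁴ − 1 = 4X⁹
      ∷ identity⁻ -[1+ 6 ] 1 14 3 9 1 0 ≡.refl     -- X¹⁴ − 4X⁹ = 1
      ∷ identity⁺ -[1+ 6 ] 1 0 4 9 1 14 ≡.refl     -- 1 + 4X⁹ = X¹⁴
      ∷ []

lemma3 : {c ℓ : Level} (R : CommutativeRing c ℓ) →
    let open CommutativeRing R in
    (θ θ⁻¹ : Carrier) → _^_ R θ 3 - θ - 1# ≈ 0# → θ * θ⁻¹ ≈ 1# →
    (a b c d e f : ℤ) → (a , b , c , d , e , f) ∈ tuples →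
    (m : ℤ) →
    ⟦ R ⟧ℤ a * zpow R θ θ⁻¹ (m +ℤ c) + ⟦ R ⟧ℤ b * zpow R θ θ⁻¹ (m +ℤ d)
    ≈ ⟦ R ⟧ℤ f * zpow R θ θ⁻¹ (m +ℤ e)
lemma3 R θ θ⁻¹ root inverse a b c d e f listed =
  lookup fifteen-identities listed
  where open RootOfPadovanCubic.Root R θ θ⁻¹ root inverse
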